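{- Let $P$ be a poset on $\{1,\ldots,n\}$, let $M$ be a maximum independent set of $G_P$ and let $J\in M$. Then any two distinct elements of $U_{max}(M,J)$ have empty intersection.
   Context: An order ideal of $P$ is a subset $J$ with $i\in J$, $j\le_P i\Rightarrow j\in J$; a nonempty order ideal is connected if the Hasse diagram of $P$ restricted to it is connected. Sets $A,B$ intersect nontrivially if $A\cap B\neq\emptyset$, $A\not\subseteq B$, $B\not\subseteq A$. $G_P$ is the simple graph whose vertices are the connected order ideals of $P$, adjacent iff they intersect nontrivially. A maximum independent set is an independent set of largest possible size. For $J\in M$: $U(M,J)=\{J'\in M : J'\subsetneq J\}$ and $U_{max}(M,J)=\{J_a\in U(M,J) : J_a\not\subsetneq J_b\text{ for every }J_b\in U(M,J)\}$. -}

module Defs where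

open import Level using (0ℓ)
open import Data.Nat using (ℕ; _≤_)
open import Data.Fin using (Fin)
open import Data.Fin.Subset using (Subset; _∈_; _∉_; _⊆_; _∩_; Nonempty; Empty)
open import Data.List using (List; length)
open import Data.List.Relation.Unary.Unique.Propositional using (Unique)
open import Data.Product using (Σ; _×_; ∃)
open import Data.Sum using (_⊎_)
open import Relation.Binary.Core using (Rel)
open import Relation.Binary.Structures using (IsPartialOrder)
open import Relation.Binary.PropositionalEquality using (_≡_; _≢_)
open import Relation.Nullary using (¬_)
import Data.List.Membership.Propositional as L

-- A poset on {1,…,n}, represented on Fin n with equality _≡_.
record FinPoset (n : ℕ) : Set₁ where
  field
    _≤P_ : Rel (Fin n) 0ℓ
    isPartialOrder : IsPartialOrder _≡_ _≤P_

module _ {n : ℕ} (P : FinPoset n) where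
  open FinPoset P

  _<P_ : Rel (Fin n) 0ℓ
  i <P j = i ≤P j × i ≢ j

  Covers : Rel (Fin n) 0ℓ
  Covers i j = i <P j × (∀ k → ¬ (i <P k × k <P j))

  HasseEdge : Rel (Fin n) 0ℓ
  HasseEdge i j = Covers i j ⊎ Covers j i

  IsOrderIdeal : Subset n → Set
  IsOrderIdeal J = ∀ i j → i ∈ J → j ≤P i → j ∈ J

  data HassePathIn (J : Subset n) : Fin n → Fin n → Set where
    here : ∀ {i} → i ∈ J → HassePathIn J i i
    step : ∀ {i k j} → i ∈ J → HasseEdge i k → HassePathIn J k j → HassePathIn J i j

  HasseConnected : Subset n → Set
  HasseConnected J = ∀ i j → i ∈ J → j ∈ J → HassePathIn J i j

  IsConnectedIdeal : Subset n → Set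
  IsConnectedIdeal J = Nonempty J × IsOrderIdeal J × HasseConnected J

  NontrivInt : Subset n → Subset n → Set
  NontrivInt A B = Nonempty (A ∩ B) × ¬ (A ⊆ B) × ¬ (B ⊆ A)

  -- independent set of G_P, given as a duplicate-free list of vertices
  IsIndependent : List (Subset n) → Set
  IsIndependent M =
    Unique M × (∀ J → J L.∈ M → IsConnectedIdeal J) ×
    (∀ A B → A L.∈ M → B L.∈ M → ¬ NontrivInt A B)

  IsMaximumIndependent : List (Subset n) → Set
  IsMaximumIndependent M =
    IsIndependent M × (∀ M′ → IsIndependent M′ → length M′ ≤ length M)

_⊂_ : ∀ {n} → Subset n → Subset n → Set
A ⊂ B = A ⊆ B × A ≢ B

InU : ∀ {n} → List (Subset n) → Subset n → Subset n → Set
InU M J J′ = J′ L.∈ M × J′ ⊂ J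

InUmax : ∀ {n} → List (Subset n) → Subset n → Subset n → Set
InUmax M J Ja = InU M J Ja × (∀ Jb → InU M J Jb → ¬ (Ja ⊂ Jb))

module Submission where

open import Defs
open import Data.Nat using (ℕ)
open import Data.Fin.Subset using (Subset; _∩_; Empty)
open import Data.List using (List)
open import Data.Product using (_,_; proj₁)
open import Relation.Binary.PropositionalEquality using (_≢_; sym)
open import Relation.Nullary using (¬_)
import Data.List.Membership.Propositional as L

-- Only independence of M is needed: its members form a laminar family, in which two
-- intersecting sets are nested, and members of U_max(M,J) are never properly nested.

laminar-incomparable⇒disjoint : ∀ {n} (P : FinPoset n) {A B : Subset n} →
  ¬ NontrivInt P A B → ¬ A ⊂ B → ¬ B ⊂ A → A ≢ B → Empty (A ∩ B)
laminar-incomparable⇒disjoint P ¬AB ¬A⊂B ¬B⊂A A≢B A∩B≠∅ =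
  ¬AB (A∩B≠∅ , (λ A⊆B → ¬A⊂B (A⊆B , A≢B)) , (λ B⊆A → ¬B⊂A (B⊆A , λ B≡A → A≢B (sym B≡A))))

Umax-incomparable : ∀ {n} {M : List (Subset n)} {J Ja Jb : Subset n} →
  InUmax M J Ja → InUmax M J Jb → ¬ Ja ⊂ Jb
Umax-incomparable (_ , maximal) (Jb∈U , _) = maximal _ Jb∈U

Umax-disjoint : ∀ {n} (P : FinPoset n) {M : List (Subset n)} → IsIndependent P M →
  ∀ {J Ja Jb} → InUmax M J Ja → InUmax M J Jb → Ja ≢ Jb → Empty (Ja ∩ Jb)
Umax-disjoint P (_ , _ , independent) a@((Ja∈M , _) , _) b@((Jb∈M , _) , _) =
  laminar-incomparable⇒disjoint P (independent _ _ Ja∈M Jb∈M)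
    (Umax-incomparable a b) (Umax-incomparable b a)

lemma2p1 : (n : ℕ) (P : FinPoset n) (M : List (Subset n)) →
    IsMaximumIndependent P M → (J : Subset n) → J L.∈ M →
    (Ja Jb : Subset n) → InUmax M J Ja → InUmax M J Jb → Ja ≢ Jb →
    Empty (Ja ∩ Jb)
lemma2p1 n P M (independent , _) J _ Ja Jb = Umax-disjoint P independent
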